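{- Let $0<\delta\le\frac{1}{35}$ and consider the packing produced by Planned-Harmonic (PH). Every reserved bin $B_i$, except possibly the last one, whose $I_{1p}$-item has actual size greater than $\frac12$ and is packed in $B_i$ together with the items of $S_i$, has total fill level (sum of actual item sizes) at least $\frac23$.
   Context: Online Bin Packing with Estimated Item Sizes: before any item is revealed the algorithm receives $\delta\in(0,1]$ and estimates $c'(a)\in(0,1]$ for every item $a$; items then arrive online with actual sizes $c(a)\in[c'(a)(1-\delta),\min(c'(a)(1+\delta),1)]$ and must be irrevocably packed into bins of capacity $1$. Planned-Harmonic (PH), planning phase: $I_{1g}=\{a:(1-\delta)c'(a)>\frac12\}$, $I_{1p}=\{a:(1+\delta)c'(a)>\frac12\}\setminus I_{1g}$, $I_{4+}=\{a:(1-\delta)c'(a)\le\frac14\}$. For each $a\in I_{1g}$, a maximal (greedily built) subset $S$ of the remaining $I_{4+}$ with $(1+\delta)(c'(a)+\sum_{a'\in S}c'(a'))\le1$ is removed from $I_{4+}$ and planned to be packed with $a$. Then for $i=1,\dots,|I_{1p}|$, stopping once $I_{4+}$ is empty, a maximal (greedily built) subset $S_i$ of the remaining $I_{4+}$ with $(1+\delta)(\frac{1}{2(1-\delta)}+\sum_{a'\in S_i}c'(a'))\le1$ is chosen and a reserved bin $B_i$ is designated for $S_i$; the bins $B_i$ are numbered in order of creation. In the update phase, items of $S_i$ are packed into $B_i$, and an $I_{1p}$-item of actual size greater than $\frac12$ is packed into the first reserved bin $B_{l+1}$ not yet containing an $I_{1p}$-item (items of $I_{1p}$ of size in $(\frac13,\frac12]$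 may also be placed in such a bin under a rule not needed here). -}

module Defs where

open import Data.Nat using (ℕ; zero; suc)
open import Data.Fin using (Fin; zero; suc)
open import Data.Vec using (Vec; []; _∷_; tabulate)
open import Data.Bool using (true; false)
open import Data.List using (List; []; _∷_)
import Data.List.Membership.Propositional as LM
open import Data.List.Relation.Unary.Unique.Propositional using (Unique)
open import Data.Fin.Subset using (Subset; _∈_; _∉_; _⊆_; _∪_; _─_; ⁅_⁆; ∣_∣; Empty; Nonempty)
open import Data.Rational using (ℚ; 0ℚ; 1ℚ; _+_; _*_; _-_; _≤_; _<_; _>_; 1/_; ≢-nonZero; ½; _/_)
open import Data.Rational.Properties using (_≟_; _≤?_; _<?_)
open import Data.Integer using (+_)
open import Data.Product using (_×_; Σ)
open import Relation.Nullary using (¬_; yes; no; does)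
open import Relation.Binary.PropositionalEquality using (_≡_)
open import Function using (_⇔_)

-- Total reciprocal (1/p for p ≠ 0, and 0 for p = 0; only used with p ≠ 0).
recip : ℚ → ℚ
recip p with p ≟ 0ℚ
... | yes _ = 0ℚ
... | no ne = 1/_ p {{≢-nonZero ne}}

wsum : ∀ {n} → Subset n → (Fin n → ℚ) → ℚ
wsum [] w = 0ℚ
wsum (true ∷ S) w = w zero + wsum S (λ i → w (suc i))
wsum (false ∷ S) w = wsum S (λ i → w (suc i))

-- An instance: n items, the parameter δ, estimates c' and actual sizes c.
record Instance (n : ℕ) : Set where
  field
    δ   : ℚ
    est : Fin n → ℚ
    act : Fin n → ℚ

module _ {n : ℕ} (I : Instance n) where
  open Instance I

  Valid : Set
  Valid = (0ℚ < δ) × (δ ≤ 1ℚ)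
        × (∀ a → (0ℚ < est a) × (est a ≤ 1ℚ)
                 × (est a * (1ℚ - δ) ≤ act a) × (act a ≤ est a * (1ℚ + δ)) × (act a ≤ 1ℚ))

  IsI1g : Fin n → Set
  IsI1g a = (1ℚ - δ) * est a > ½

  IsI1p : Fin n → Set
  IsI1p a = ((1ℚ + δ) * est a > ½) × ¬ IsI1g a

  I1p : Subset n
  I1p = tabulate (λ a → does ((½ <? (1ℚ + δ) * est a)) Data.Bool.∧ Data.Bool.not (does (½ <? (1ℚ - δ) * est a)))

  I4+ : Subset n
  I4+ = tabulate (λ a → does ((1ℚ - δ) * est a ≤? + 1 / 4))

  Fits : ℚ → Subset n → Set
  Fits base S = (1ℚ + δ) * (base + wsum S est) ≤ 1ℚ

  -- S is a maximal subset of R satisfying Fits base (what greedy produces)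
  MaxFit : ℚ → Subset n → Subset n → Set
  MaxFit base R S = (S ⊆ R) × Fits base S × (∀ a → a ∈ R → a ∉ S → ¬ Fits base (S ∪ ⁅ a ⁆))

  -- Phase 1: the I1g items are processed in the order of the list;
  -- Phase1 R gs R' : starting from remaining set R, ending with remaining set R'.
  data Phase1 : Subset n → List (Fin n) → Subset n → Set where
    done : ∀ {R} → Phase1 R [] R
    step : ∀ {R g gs R'} (T : Subset n) → MaxFit (est g) R T
         → Phase1 (R ─ T) gs R' → Phase1 R (g ∷ gs) R'

  EnumI1g : List (Fin n) → Set
  EnumI1g gs = Unique gs × (∀ a → (a LM.∈ gs) ⇔ IsI1g a)

  reservedBase : ℚ
  reservedBase = recip ((+ 2 / 1) * (1ℚ - δ))

  -- Phase 2: Phase2 R m Ss : remaining set R, at most m further reserved bins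
  -- (m = |I1p| initially), Ss the list S_1, S_2, … of the created reserved bins in order.
  data Phase2 : Subset n → ℕ → List (Subset n) → Set where
    stop-empty  : ∀ {R m} → Empty R → Phase2 R m []
    stop-budget : ∀ {R} → Phase2 R 0 []
    step        : ∀ {R m Ss} (S : Subset n) → Nonempty R → MaxFit reservedBase R S
                → Phase2 (R ─ S) m Ss → Phase2 R (suc m) (S ∷ Ss)

{-# OPTIONS --safe #-}
module Submission where

-- If B_i is not the last reserved bin, the greedy choice of S_i stopped while
-- items of I_{4+} were still unplanned, so one of them, a, did not fit:
-- (1+δ)(1/(2(1-δ)) + c'(S_i) + c'(a)) > 1.  Multiplying by 1-δ and using
-- (1-δ)c'(S_i) ≤ c(S_i) and (1-δ)c'(a) ≤ 1/4 gives
-- 1-δ < (1+δ)(1/2 + c(S_i) + 1/4).  If the fill were below 2/3, the I_{1p}-item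
-- (of size > 1/2) would force c(S_i) < 1/6, hence 1-δ < (1+δ)·11/12, which is
-- false for δ ≤ 1/23.

open import Defs
open import Data.Bool using (true; false)
open import Data.Empty using (⊥-elim)
open import Data.Nat using (ℕ)
open import Data.Fin using (Fin; zero; suc)
open import Data.Fin.Subset using (Subset; _∈_; _∉_; _⊆_; _∪_; _─_; ⁅_⁆; ∣_∣; Nonempty)
open import Data.Fin.Subset.Properties using (p─q⊆p; ∪-identityʳ)
open import Data.Integer using (+_)
open import Data.List using (List; []; _∷_; _++_)
open import Data.List.Properties using (∷-injective)
open import Data.Product using (Σ; _×_; _,_)
open import Data.Rational
  using (ℚ; 0ℚ; 1ℚ; ½; _+_; _-_; _*_; _/_; _≤_; _<_; _≤?_; _<?_; ≢-nonZero; NonNegative; positive; nonNegative)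
open import Data.Rational.Properties
  using ( _≟_; ≤-reflexive; ≤-trans; <-trans; <⇒≤; <⇒≢; <-irrefl; ≮⇒≥; ≰⇒>; <-≤-trans; module ≤-Reasoning
        ; +-comm; +-assoc; +-monoʳ-≤; +-mono-≤; +-mono-<-≤; neg-antimono-≤
        ; *-identityʳ; *-zeroˡ; *-distribʳ-+; *-inverseʳ
        ; *-monoʳ-<-pos; *-monoˡ-≤-nonNeg; *-monoʳ-≤-nonNeg )
open import Data.Rational.Solver using (module +-*-Solver)
open import Data.Vec using ([]; _∷_; here; there)
open import Data.Vec.Properties using ([]=⇒lookup; lookup∘tabulate)
open import Function using (_∘_; id)
open import Relation.Binary.PropositionalEquality using (_≡_; _≢_; refl; sym; trans; cong; subst)
open import Relation.Nullary using (yes; no; does; proof; Reflects; invert)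
open import Relation.Nullary.Decidable using (from-yes)

x∈p─q⇒x∉q : ∀ {n} {x : Fin n} (p q : Subset n) → x ∈ p ─ q → x ∉ q
x∈p─q⇒x∉q (true ∷ p) (false ∷ q) here ()
x∈p─q⇒x∉q (_ ∷ p) (_ ∷ q) (there x∈p─q) (there x∈q) = x∈p─q⇒x∉q p q x∈p─q x∈q

wsum-∪-⁅⁆ : ∀ {n} (S : Subset n) {a : Fin n} (w : Fin n → ℚ) → a ∉ S
          → wsum (S ∪ ⁅ a ⁆) w ≡ wsum S w + w a
wsum-∪-⁅⁆ (true ∷ S) {zero} w a∉S = ⊥-elim (a∉S here)
wsum-∪-⁅⁆ (false ∷ S) {zero} w a∉S
  rewrite ∪-identityʳ S = +-comm (w zero) (wsum S (w ∘ suc))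
wsum-∪-⁅⁆ (true ∷ S) {suc a} w a∉S = trans
  (cong (λ s → w zero + s) (wsum-∪-⁅⁆ S (w ∘ suc) (a∉S ∘ there)))
  (sym (+-assoc (w zero) _ _))
wsum-∪-⁅⁆ (false ∷ S) {suc a} w a∉S = wsum-∪-⁅⁆ S (w ∘ suc) (a∉S ∘ there)

wsum-*-≤ : ∀ {n} (S : Subset n) {w v : Fin n → ℚ} (c : ℚ)
         → (∀ i → w i * c ≤ v i) → wsum S w * c ≤ wsum S v
wsum-*-≤ [] c w*c≤v = ≤-reflexive (*-zeroˡ c)
wsum-*-≤ (true ∷ S) {w} c w*c≤v = ≤-trans
  (≤-reflexive (*-distribʳ-+ c (w zero) _))
  (+-mono-≤ (w*c≤v zero) (wsum-*-≤ S c (w*c≤v ∘ suc)))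
wsum-*-≤ (false ∷ S) c w*c≤v = wsum-*-≤ S c (w*c≤v ∘ suc)

recip-inverseʳ : ∀ p → p ≢ 0ℚ → p * recip p ≡ 1ℚ
recip-inverseʳ p p≢0 with p ≟ 0ℚ
... | yes p≡0 = ⊥-elim (p≢0 p≡0)
... | no  p≢0′ = *-inverseʳ p {{≢-nonZero p≢0′}}

*-recip[2*]≡½ : ∀ u → 0ℚ < u → u * recip ((+ 2 / 1) * u) ≡ ½
*-recip[2*]≡½ u 0<u = begin
  u * r                       ≡⟨ halve u r ⟩
  ½ * ((+ 2 / 1) * u * r)     ≡⟨ cong (½ *_) (recip-inverseʳ _ (<⇒≢ 0<2u ∘ sym)) ⟩
  ½ * 1ℚ                      ≡⟨ *-identityʳ ½ ⟩
  ½                           ∎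
  where
  open Relation.Binary.PropositionalEquality.≡-Reasoning
  open +-*-Solver
  r : ℚ
  r = recip ((+ 2 / 1) * u)
  0<2u : 0ℚ < (+ 2 / 1) * u
  0<2u = *-monoʳ-<-pos (+ 2 / 1) 0<u
  halve : ∀ u r → u * r ≡ ½ * ((+ 2 / 1) * u * r)
  halve = solve 2 (λ u r → u :* r := con ½ :* ((con (+ 2 / 1) :* u) :* r)) refl

0<1-δ : ∀ {δ} → δ ≤ + 1 / 23 → 0ℚ < 1ℚ - δ
0<1-δ δ≤ = <-≤-trans (from-yes (0ℚ <? 1ℚ - + 1 / 23)) (+-monoʳ-≤ 1ℚ (neg-antimono-≤ δ≤))

[1+δ]*11/12≤1-δ : ∀ {δ} → δ ≤ + 1 / 23 → (1ℚ + δ) * (+ 11 / 12) ≤ 1ℚ - δ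
[1+δ]*11/12≤1-δ {δ} δ≤ = begin
  (1ℚ + δ) * (+ 11 / 12)         ≤⟨ *-monoʳ-≤-nonNeg (+ 11 / 12) (+-monoʳ-≤ 1ℚ δ≤) ⟩
  (1ℚ + + 1 / 23) * (+ 11 / 12)  ≡⟨⟩
  1ℚ - + 1 / 23                  ≤⟨ +-monoʳ-≤ 1ℚ (neg-antimono-≤ δ≤) ⟩
  1ℚ - δ                         ∎
  where open ≤-Reasoning

overflow-scaled : ∀ δ B E e → 0ℚ < 1ℚ - δ → (1ℚ - δ) * B ≡ ½
                → 1ℚ < (1ℚ + δ) * (B + (E + e))
                → 1ℚ - δ < (1ℚ + δ) * (½ + (E * (1ℚ - δ) + (1ℚ - δ) * e))
overflow-scaled δ B E e 0<1-δ [1-δ]B≡½ overflow = begin-strict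
  1ℚ - δ                                                     ≡⟨ sym (*-identityʳ (1ℚ - δ)) ⟩
  (1ℚ - δ) * 1ℚ                                              <⟨ *-monoʳ-<-pos (1ℚ - δ) {{positive 0<1-δ}} overflow ⟩
  (1ℚ - δ) * ((1ℚ + δ) * (B + (E + e)))                      ≡⟨ distribute (1ℚ - δ) (1ℚ + δ) B E e ⟩
  (1ℚ + δ) * ((1ℚ - δ) * B + (E * (1ℚ - δ) + (1ℚ - δ) * e))  ≡⟨ cong (λ b → (1ℚ + δ) * (b + _)) [1-δ]B≡½ ⟩
  (1ℚ + δ) * (½ + (E * (1ℚ - δ) + (1ℚ - δ) * e))             ∎
  where
  open ≤-Reasoning
  open +-*-Solver
  distribute : ∀ u v B E e → u * (v * (B + (E + e))) ≡ v * (u * B + (E * u + u * e))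
  distribute = solve 5 (λ u v B E e → u :* (v :* (B :+ (E :+ e))) := v :* (u :* B :+ (E :* u :+ u :* e))) refl

fill≥2/3 : ∀ δ B E e A X → 0ℚ ≤ δ → δ ≤ + 1 / 23 → (1ℚ - δ) * B ≡ ½
         → 1ℚ < (1ℚ + δ) * (B + (E + e)) → (1ℚ - δ) * e ≤ + 1 / 4
         → E * (1ℚ - δ) ≤ A → ½ < X → + 2 / 3 ≤ X + A
fill≥2/3 δ B E e A X 0≤δ δ≤ [1-δ]B≡½ overflow [1-δ]e≤1/4 E≤A ½<X = ≮⇒≥ λ X+A<2/3 →
  <-irrefl refl (begin-strict
    1ℚ - δ                                          <⟨ overflow-scaled δ B E e (0<1-δ δ≤) [1-δ]B≡½ overflow ⟩
    (1ℚ + δ) * (½ + (E * (1ℚ - δ) + (1ℚ - δ) * e))  ≤⟨ *-monoˡ-≤-nonNeg (1ℚ + δ) {{0≤1+δ}} (bracket≤11/12 X+A<2/3) ⟩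
    (1ℚ + δ) * (+ 11 / 12)                          ≤⟨ [1+δ]*11/12≤1-δ δ≤ ⟩
    1ℚ - δ                                          ∎)
  where
  open ≤-Reasoning
  0≤1+δ : NonNegative (1ℚ + δ)
  0≤1+δ = nonNegative (+-mono-≤ (from-yes (0ℚ ≤? 1ℚ)) 0≤δ)
  bracket≤11/12 : X + A < + 2 / 3 → ½ + (E * (1ℚ - δ) + (1ℚ - δ) * e) ≤ + 11 / 12
  bracket≤11/12 X+A<2/3 = begin
    ½ + (E * (1ℚ - δ) + (1ℚ - δ) * e)   ≡⟨ sym (+-assoc ½ (E * (1ℚ - δ)) ((1ℚ - δ) * e)) ⟩
    ½ + E * (1ℚ - δ) + (1ℚ - δ) * e     ≤⟨ +-mono-≤ (<⇒≤ (<-trans (+-mono-<-≤ ½<X E≤A) X+A<2/3)) [1-δ]e≤1/4 ⟩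
    + 2 / 3 + + 1 / 4                   ≡⟨⟩
    + 11 / 12                           ∎

module _ {n : ℕ} (I : Instance n) where
  open Instance I

  I4+-bound : ∀ {a} → a ∈ I4+ I → (1ℚ - δ) * est a ≤ + 1 / 4
  I4+-bound {a} a∈I4+ = invert (subst (Reflects _) does≡true (proof ((1ℚ - δ) * est a ≤? + 1 / 4)))
    where
    does≡true : does ((1ℚ - δ) * est a ≤? + 1 / 4) ≡ true
    does≡true = trans (sym (lookup∘tabulate _ a)) ([]=⇒lookup a∈I4+)

  Phase1-⊆ : ∀ {R gs R′} → Phase1 I R gs R′ → R′ ⊆ R
  Phase1-⊆ done                    = id
  Phase1-⊆ (step {R = R} T _ rest) = p─q⊆p R T ∘ Phase1-⊆ rest

  MaxFit-overflow : ∀ {base R S a} → MaxFit I base R S → a ∈ R ─ S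
                  → 1ℚ < (1ℚ + δ) * (base + (wsum S est + est a))
  MaxFit-overflow {base} {R} {S} {a} (_ , _ , maximal) a∈R─S
    = subst (λ s → 1ℚ < (1ℚ + δ) * (base + s)) (wsum-∪-⁅⁆ S est a∉S)
            (≰⇒> (maximal a (p─q⊆p R S a∈R─S) a∉S))
    where
    a∉S : a ∉ S
    a∉S = x∈p─q⇒x∉q R S a∈R─S

  Phase2-non-last : ∀ {R m Ss} → Phase2 I R m Ss
                  → ∀ pre S T post → Ss ≡ pre ++ S ∷ T ∷ post
                  → Σ (Subset n) λ R′ → R′ ⊆ R × MaxFit I (reservedBase I) R′ S × Nonempty (R′ ─ S)
  Phase2-non-last (step _ _ maxFit (step _ nonempty _ _)) [] S T post refl =
    _ , id , maxFit , nonempty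
  Phase2-non-last (step {R = R} S′ _ _ rest) (_ ∷ pre) S T post Ss≡
    with refl , Ss≡′ ← ∷-injective Ss≡
    with R′ , R′⊆R , maxFit , nonempty ← Phase2-non-last rest pre S T post Ss≡′ =
    R′ , p─q⊆p R S′ ∘ R′⊆R , maxFit , nonempty

lemma1 : ∀ {n} (I : Instance n) → Valid I → Instance.δ I ≤ + 1 / 35
       → ∀ (gs : List (Fin n)) (R₁ : Subset n) (Ss : List (Subset n))
       → EnumI1g I gs → Phase1 I (I4+ I) gs R₁ → Phase2 I R₁ ∣ I1p I ∣ Ss
       → ∀ (pre : List (Subset n)) (S T : Subset n) (post : List (Subset n))
       → Ss ≡ pre ++ S ∷ T ∷ post
       → ∀ (x : Fin n) → x ∈ I1p I → ½ < Instance.act I x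
       → + 2 / 3 ≤ Instance.act I x + wsum S (Instance.act I)
-- Only ½ < c(x) is used: neither the class of x nor the order of phase 1 matters.
lemma1 I (0<δ , _ , sizes) δ≤ _ _ _ _ phase1 phase2 pre S T post Ss≡ x _ ½<x
  with R , R⊆R₁ , maxFit , (a , a∈R─S) ← Phase2-non-last I phase2 pre S T post Ss≡ =
  fill≥2/3 δ (reservedBase I) (wsum S est) (est a) (wsum S act) (act x)
    (<⇒≤ 0<δ) δ≤1/23
    (*-recip[2*]≡½ (1ℚ - δ) (0<1-δ δ≤1/23))
    (MaxFit-overflow I {base = reservedBase I} maxFit a∈R─S)
    (I4+-bound I (Phase1-⊆ I phase1 (R⊆R₁ (p─q⊆p R S a∈R─S))))
    (wsum-*-≤ S (1ℚ - δ) est*[1-δ]≤act)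
    ½<x
  where
  open Instance I
  δ≤1/23 : δ ≤ + 1 / 23
  δ≤1/23 = ≤-trans δ≤ (from-yes (+ 1 / 35 ≤? + 1 / 23))
  est*[1-δ]≤act : ∀ a → est a * (1ℚ - δ) ≤ act a
  est*[1-δ]≤act a with _ , _ , est*[1-δ]≤act-a , _ ← sizes a = est*[1-δ]≤act-a
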